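{- Every branch that is refutable in the tableau calculus $\mathcal T_{\mathrm{EFO}}$ is unsatisfiable.
   Context: Types are generated from countably many base types by: if $\sigma,\tau$ are types then $\sigma\tau$ is a type. One base type $o$ is fixed; the others are sorts ($\alpha$). Countably many names, each with a unique type, infinitely many of every type. Terms: names; $st$ of type $\mu$ for $s$ of type $\tau\mu$, $t$ of type $\tau$; $\lambda x.t$ of type $\sigma\tau$ for a name $x$ of type $\sigma$, $t$ of type $\tau$. $\Lambda_\alpha$ is the set of terms of type $\alpha$. Logical constants: $\neg:oo$, $\to:ooo$, $=_\sigma:\sigma\sigma o$ for every type $\sigma$, $\forall_\alpha:(\alpha o)o$ for every sort $\alpha$; other names are variables. EFO constants: $\neg,\to,=_\alpha,\forall_\alpha$. Formulas are terms of type $o$; $s=_\sigma t$ is $(=_\sigma)st$, $s\neq_\sigma t$ is $\neg(s=_\sigma t)$, $s\to t$ is $(\to)st$, $\forall_\alpha s$ is $(\forall_\alpha)s$. A term is EFO if its only logical constants are EFO constants; quasi-EFO if EFO or of the form $s\neq_\sigma t$ with $s,t$ EFO. A frame maps types to nonempty sets with $\mathcal D(\sigma\tau)\subseteq(\mathcal D\sigma\to\mathcal D\tau)$. An assignment $\mathcal I$ into $\mathcal D$ extends $\mathcal D$ and maps names of type $\sigma$ into $\mathcal D\sigma$. Partial evaluation: $\hat{\mathcal I}x=\mathcal Ix$; $\hat{\mathcal I}(st)=(\hat{\mathcal I}s)(\hat{\mathcal I}t)$; $\hat{\mathcal I}(\lambda x.s)=f$ if $\lambda x.s$ has type $\sigma\tau$,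 $f\in\mathcal D(\sigma\tau)$, and $\widehat{\mathcal I^x_a}s=fa$ for all $a\in\mathcal D\sigma$. An interpretation is an assignment with total evaluation. Logical: $\mathcal Io=\{0,1\}$, $\neg$ negation, $\to$ implication, $=_\sigma$ identity, $\mathcal I(\forall_\alpha)f=1$ iff $f$ is the constant function $1$. A model of a set of formulas is a logical interpretation giving every member value $1$; satisfiable means having a model. A fixed normalization operator $s\mapsto[s]$ (type-preserving, total) satisfies (N1) $[[s]]=[s]$; (N2) $[[s]t]=[st]$; (N3) $[xs_1\dots s_n]=x[s_1]\dots[s_n]$ for a name $x$, $n\ge0$, base type; (N4) $\hat{\mathcal I}[s]=\hat{\mathcal I}s$ for interpretations. Normal: $[s]=s$. An EFO branch is a set of normal quasi-EFO formulas. A term $u\in\Lambda_\alpha$ is $\alpha$-discriminating in $A$ if $u\neq_\alpha t\in A$ or $t\neq_\alpha u\in A$ for some $t$. The calculus $\mathcal T_{\mathrm{EFO}}$ works on finite EFO branches. A rule instance $A/A_1,\dots,A_n$ ($n\ge0$): $A$ contains the rule's premises and $A_i=A\cup C_i$ for the alternatives $C_1\mid\dots\mid C_n$. Rules: (DN) $\neg\neg s$: $\{s\}$; (BE) $s\neq_o t$: $\{s,\neg t\}\mid\{\neg s,t\}$; (Imp) $s\to t$: $\{\neg s\}\mid\{t\}$; (ImpN) $\neg(s\to t)$: $\{s,\neg t\}$; (Mat) $xs_1\dots s_n,\neg xt_1\dots t_n$ ($x$ a variable, $n\ge0$): $\{s_1\neq t_1\}\mid\dots\mid\{s_n\neq t_n\}$;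 (Dec) $xs_1\dots s_n\neq_\alpha xt_1\dots t_n$ ($x$ a variable, $n\ge0$): same; (FE) $s\neq_{\sigma\tau}t$: $\{[sx]\neq[tx]\}$, $x$ a variable of type $\sigma$ not free in $A$; (Con) $s=_\alpha t,u\neq_\alpha v$: $\{s\neq u,t\neq u\}\mid\{s\neq v,t\neq v\}$; (All) $\forall_\alpha s$: $\{[su]\}$ for a normal EFO term $u$ of type $\alpha$; (AllN) $\neg\forall_\alpha s$: $\{\neg[sx]\}$, $x$ a variable of type $\alpha$ not free in $A$. A branch is closed if it contains $x,\neg x$ for a variable $x$ of type $o$ or $x\neq_\alpha x$ for a variable $x$ of sort $\alpha$. Restrictions: (1) apart from the instances of Mat and Dec with $n=0$, instances are admitted only if $A$ is not closed; (2) FE applies to $s\neq t\in A$ only if there is no variable $x$ with $[sx]\neq[tx]\in A$; (3) AllN applies to $\neg\forall_\alpha s\in A$ only if there is no variable $x$ of type $\alpha$ with $\neg[sx]\in A$; (4) if $\forall_\alpha s\in A$ and there are $\alpha$-discriminating terms in $A$, All may only use such terms $u$; (5) if $\forall_\alpha s\in A$, $[su]\notin A$ for all normal $u\in\Lambda_\alpha$, there are no $\alpha$-discriminating terms in $A$ and some variable of type $\alpha$ occurs free in $A$, All may only use a variable of type $\alpha$ occurring free in $A$; (6) if in that situation no variable of type $\alpha$ occurs free in $A$, All may only use a variable of type $\alpha$. The refutable branches form the least set such that if $A/A_1,\dots,A_n$ is an admitted instance with all $A_i$ refutable then $A$ is refutable. -}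

module Defs where

open import Data.Nat using (ℕ)
open import Data.Nat.Properties using () renaming (_≟_ to _≟ℕ_)
open import Data.Bool using (Bool; true; false; not; _∧_; _∨_)
open import Data.Product using (Σ; ∃; ∃-syntax; _×_; _,_; proj₁)
open import Data.Sum using (_⊎_)
open import Data.Unit using (⊤)
open import Data.Empty using (⊥)
open import Data.List using (List; []; _∷_; _++_)
open import Data.List.Relation.Unary.All using (All)
open import Data.List.Membership.Propositional using (_∈_; _∉_)
open import Relation.Nullary using (¬_; Dec; yes; no)
open import Relation.Binary.PropositionalEquality using (_≡_; refl)

-- Types.  Base types: the fixed type o and countably many sorts (sort n).
-- σ ⇒ τ is the paper's type στ.

infixr 7 _⇒_
data Ty : Set where
  o    : Ty
  sort : ℕ → Ty
  _⇒_  : Ty → Ty → Ty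

data Base : Ty → Set where
  base-o    : Base o
  base-sort : ∀ n → Base (sort n)

_⇛_ : List Ty → Ty → Ty
[] ⇛ ρ = ρ
(σ ∷ σs) ⇛ ρ = σ ⇒ (σs ⇛ ρ)

data Name : Ty → Set where
  neg : Name (o ⇒ o)
  imp : Name (o ⇒ o ⇒ o)
  eq  : (σ : Ty) → Name (σ ⇒ σ ⇒ o)
  all : (α : ℕ) → Name ((sort α ⇒ o) ⇒ o)
  var : (σ : Ty) → ℕ → Name σ

SameName : ∀ {σ τ} → Name σ → Name τ → Set
SameName {σ} {τ} x y = _≡_ {A = Σ Ty Name} (σ , x) (τ , y)

_≟Ty_ : (σ τ : Ty) → Dec (σ ≡ τ)
o ≟Ty o = yes refl
o ≟Ty sort _ = no λ ()
o ≟Ty (_ ⇒ _) = no λ ()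
sort _ ≟Ty o = no λ ()
sort m ≟Ty sort n with m ≟ℕ n
... | yes refl = yes refl
... | no ne = no λ { refl → ne refl }
sort _ ≟Ty (_ ⇒ _) = no λ ()
(_ ⇒ _) ≟Ty o = no λ ()
(_ ⇒ _) ≟Ty sort _ = no λ ()
(σ ⇒ τ) ≟Ty (σ' ⇒ τ') with σ ≟Ty σ' | τ ≟Ty τ'
... | yes refl | yes refl = yes refl
... | no ne | _ = no λ { refl → ne refl }
... | yes _ | no ne = no λ { refl → ne refl }

_≟Name_ : ∀ {σ} → (x y : Name σ) → Dec (x ≡ y)
neg ≟Name neg = yes refl
neg ≟Name var _ _ = no λ ()
imp ≟Name imp = yes refl
imp ≟Name var _ _ = no λ ()
imp ≟Name eq _ = no λ ()
eq _ ≟Name imp = no λ ()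
eq σ ≟Name eq .σ = yes refl
eq σ ≟Name var _ _ = no λ ()
all α ≟Name all .α = yes refl
all α ≟Name var _ _ = no λ ()
var _ _ ≟Name neg = no λ ()
var _ _ ≟Name imp = no λ ()
var _ _ ≟Name eq _ = no λ ()
var _ _ ≟Name all _ = no λ ()
var σ m ≟Name var .σ n with m ≟ℕ n
... | yes refl = yes refl
... | no ne = no λ { refl → ne refl }

data Tm : Ty → Set where
  nm  : ∀ {σ} → Name σ → Tm σ
  app : ∀ {σ τ} → Tm (σ ⇒ τ) → Tm σ → Tm τ
  lam : ∀ {σ τ} → Name σ → Tm τ → Tm (σ ⇒ τ)

data Args : List Ty → Set where
  []  : Args []
  _∷_ : ∀ {σ σs} → Tm σ → Args σs → Args (σ ∷ σs)

_·_ : ∀ {σs ρ} → Tm (σs ⇛ ρ) → Args σs → Tm ρ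
s · [] = s
s · (t ∷ ts) = app s t · ts

mapArgs : (∀ {σ} → Tm σ → Tm σ) → ∀ {σs} → Args σs → Args σs
mapArgs f [] = []
mapArgs f (t ∷ ts) = f t ∷ mapArgs f ts

¬' : Tm o → Tm o
¬' s = app (nm neg) s

_⟶_ : Tm o → Tm o → Tm o
s ⟶ t = app (app (nm imp) s) t

_≐_ : ∀ {σ} → Tm σ → Tm σ → Tm o
_≐_ {σ} s t = app (app (nm (eq σ)) s) t

_≠_ : ∀ {σ} → Tm σ → Tm σ → Tm o
s ≠ t = ¬' (s ≐ t)

∀'[_]_ : (α : ℕ) → Tm (sort α ⇒ o) → Tm o
∀'[ α ] s = app (nm (all α)) s

data FreeIn {σ} (x : Name σ) : ∀ {τ} → Tm τ → Set where
  free-nm   : ∀ {τ} {y : Name τ} → SameName x y → FreeIn x (nm y)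
  free-appˡ : ∀ {τ ρ} {s : Tm (τ ⇒ ρ)} {t : Tm τ} → FreeIn x s → FreeIn x (app s t)
  free-appʳ : ∀ {τ ρ} {s : Tm (τ ⇒ ρ)} {t : Tm τ} → FreeIn x t → FreeIn x (app s t)
  free-lam  : ∀ {τ ρ} {y : Name τ} {s : Tm ρ} → ¬ SameName x y → FreeIn x s → FreeIn x (lam y s)

FreeInBranch : ∀ {σ} → Name σ → List (Tm o) → Set
FreeInBranch x A = ∃[ s ] (s ∈ A × FreeIn x s)

data EFOName : ∀ {σ} → Name σ → Set where
  efo-neg : EFOName neg
  efo-imp : EFOName imp
  efo-eq  : ∀ α → EFOName (eq (sort α))
  efo-all : ∀ α → EFOName (all α)
  efo-var : ∀ σ n → EFOName (var σ n)

data EFO : ∀ {σ} → Tm σ → Set where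
  efo-nm  : ∀ {σ} {x : Name σ} → EFOName x → EFO (nm x)
  efo-app : ∀ {σ τ} {s : Tm (σ ⇒ τ)} {t : Tm σ} → EFO s → EFO t → EFO (app s t)
  efo-lam : ∀ {σ τ} {x : Name σ} {s : Tm τ} → EFOName x → EFO s → EFO (lam x s)

QuasiEFO : Tm o → Set
QuasiEFO s = EFO s ⊎ (Σ Ty λ σ → Σ (Tm σ) λ a → Σ (Tm σ) λ b → (s ≡ (a ≠ b) × EFO a × EFO b))

-- Frames, assignments, evaluation.
-- A frame: nonempty sets D σ with D (σ ⇒ τ) a subset of the functions
-- D σ → D τ, encoded as a set with an extensional (injective) application.

record Frame : Set₁ where
  field
    D   : Ty → Set
    inh : ∀ σ → D σ
    ap  : ∀ {σ τ} → D (σ ⇒ τ) → D σ → D τ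
    ext : ∀ {σ τ} (f g : D (σ ⇒ τ)) → (∀ a → ap f a ≡ ap g a) → f ≡ g

module _ (F : Frame) where
  open Frame F

  Asg : Set
  Asg = ∀ {σ} → Name σ → D σ

  update : Asg → ∀ {σ} → Name σ → D σ → Asg
  update I {σ} x a {τ} y with σ ≟Ty τ
  ... | no _ = I y
  ... | yes refl with x ≟Name y
  ...   | yes _ = a
  ...   | no _ = I y

  -- partial evaluation, as a relation: Eval I s a  means  Î s = a
  data Eval : Asg → ∀ {σ} → Tm σ → D σ → Set where
    ev-nm  : ∀ {I : Asg} {σ} (x : Name σ) → Eval I (nm x) (I x)
    ev-app : ∀ {I : Asg} {σ τ} {s : Tm (σ ⇒ τ)} {t : Tm σ} {f a}
             → Eval I s f → Eval I t a → Eval I (app s t) (ap f a)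
    ev-lam : ∀ {I : Asg} {σ τ} {x : Name σ} {s : Tm τ} {f : D (σ ⇒ τ)}
             → (∀ a → Eval (update I x a) s (ap f a)) → Eval I (lam x s) f

  record Interp : Set where
    field
      asg   : Asg
      total : ∀ {σ} (s : Tm σ) → ∃[ a ] Eval asg s a

    val : ∀ {σ} → Tm σ → D σ
    val s = proj₁ (total s)

  -- logical interpretations: D o is {0,1} (given by a bijection with Bool)
  -- and the logical constants denote negation, implication, identity and
  -- the test for being the constant function 1
  record Logical (𝓘 : Interp) : Set where
    open Interp 𝓘
    field
      bool     : D o → Bool
      bool-inj : ∀ a b → bool a ≡ bool b → a ≡ b
      bool-sur : ∀ b → ∃[ a ] bool a ≡ b
      l-neg : ∀ a → bool (ap (asg neg) a) ≡ not (bool a)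
      l-imp : ∀ a b → bool (ap (ap (asg imp) a) b) ≡ (not (bool a) ∨ bool b)
      l-eq₁ : ∀ σ (a b : D σ) → bool (ap (ap (asg (eq σ)) a) b) ≡ true → a ≡ b
      l-eq₂ : ∀ σ (a b : D σ) → a ≡ b → bool (ap (ap (asg (eq σ)) a) b) ≡ true
      l-all₁ : ∀ α (f : D (sort α ⇒ o)) → bool (ap (asg (all α)) f) ≡ true
               → ∀ a → bool (ap f a) ≡ true
      l-all₂ : ∀ α (f : D (sort α ⇒ o)) → (∀ a → bool (ap f a) ≡ true)
               → bool (ap (asg (all α)) f) ≡ true

  record Model (A : List (Tm o)) : Set where
    field
      interp  : Interp
      logical : Logical interp
    open Interp interp
    open Logical logical
    field
      sat : ∀ {s} → s ∈ A → bool (val s) ≡ true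

Satisfiable : List (Tm o) → Set₁
Satisfiable A = Σ Frame λ F → Model F A

record Normalizer : Set₁ where
  field
    [_] : ∀ {σ} → Tm σ → Tm σ
    N1 : ∀ {σ} (s : Tm σ) → [ [ s ] ] ≡ [ s ]
    N2 : ∀ {σ τ} (s : Tm (σ ⇒ τ)) (t : Tm σ) → [ app [ s ] t ] ≡ [ app s t ]
    N3 : ∀ {σs ρ} → Base ρ → (x : Name (σs ⇛ ρ)) (ss : Args σs)
         → [ nm x · ss ] ≡ nm x · mapArgs [_] ss
    N4 : (F : Frame) (𝓘 : Interp F) → ∀ {σ} (s : Tm σ)
         → Interp.val 𝓘 [ s ] ≡ Interp.val 𝓘 s

-- The tableau calculus T_EFO, relative to a normalization operator.
-- Finite branches are lists; all notions below depend only on membership.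

module Calculus (𝒩 : Normalizer) where
  open Normalizer 𝒩

  Normal : ∀ {σ} → Tm σ → Set
  Normal s = [ s ] ≡ s

  EFOBranch : List (Tm o) → Set
  EFOBranch A = All (λ s → Normal s × QuasiEFO s) A

  Discriminating : List (Tm o) → (α : ℕ) → Tm (sort α) → Set
  Discriminating A α u =
    ∃[ t ] ((u ≠ t) ∈ A ⊎ (t ≠ u) ∈ A)

  HasDiscriminating : List (Tm o) → ℕ → Set
  HasDiscriminating A α = ∃[ u ] Discriminating A α u

  IsVar : ∀ {σ} → Tm σ → Set
  IsVar {σ} u = ∃[ k ] (u ≡ nm (var σ k))

  IsFreeVar : ∀ {σ} → List (Tm o) → Tm σ → Set
  IsFreeVar {σ} A u = ∃[ k ] (u ≡ nm (var σ k) × FreeInBranch (var σ k) A)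

  data Closed (A : List (Tm o)) : Set where
    closed-o    : ∀ k → nm (var o k) ∈ A → ¬' (nm (var o k)) ∈ A → Closed A
    closed-sort : ∀ α k → (nm (var (sort α) k) ≠ nm (var (sort α) k)) ∈ A
                  → Closed A

  disagree : ∀ {σs} → Args σs → Args σs → List (List (Tm o))
  disagree [] [] = []
  disagree (_∷_ {σ} s ss) (t ∷ ts) = ((s ≠ t) ∷ []) ∷ disagree ss ts

  -- restrictions (4)–(6) on the instantiation term u of rule All
  AllAdmissible : List (Tm o) → (α : ℕ) → Tm (sort α ⇒ o) → Tm (sort α) → Set
  AllAdmissible A α s u =
    (HasDiscriminating A α → Discriminating A α u) ×
    ((∀ (u' : Tm (sort α)) → Normal u' → [ app s u' ] ∉ A) →
     ¬ HasDiscriminating A α →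
       ((∃[ k ] FreeInBranch (var (sort α) k) A) → IsFreeVar A u) ×
       (¬ (∃[ k ] FreeInBranch (var (sort α) k) A) → IsVar u))

  -- admitted rule instances  A / A ∪ C₁, …, A ∪ Cₙ  (listing C₁ … Cₙ),
  -- including restrictions (1)–(6)
  data Step (A : List (Tm o)) : List (List (Tm o)) → Set where
    ruleDN : ∀ {s : Tm o} → ¬ Closed A → ¬' (¬' s) ∈ A → Step A ((s ∷ []) ∷ [])
    ruleBE : ∀ {s t : Tm o} → ¬ Closed A → (s ≠ t) ∈ A
           → Step A ((s ∷ ¬' t ∷ []) ∷ (¬' s ∷ t ∷ []) ∷ [])
    ruleImp : ∀ {s t : Tm o} → ¬ Closed A → (s ⟶ t) ∈ A
           → Step A ((¬' s ∷ []) ∷ (t ∷ []) ∷ [])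
    ruleImpN : ∀ {s t : Tm o} → ¬ Closed A → ¬' (s ⟶ t) ∈ A
           → Step A ((s ∷ ¬' t ∷ []) ∷ [])
    ruleMat : ∀ {σs} k (ss ts : Args σs) → (σs ≡ [] ⊎ ¬ Closed A)
           → (nm (var (σs ⇛ o) k) · ss) ∈ A
           → ¬' (nm (var (σs ⇛ o) k) · ts) ∈ A
           → Step A (disagree ss ts)
    ruleDec : ∀ {σs} α k (ss ts : Args σs) → (σs ≡ [] ⊎ ¬ Closed A)
           → ((nm (var (σs ⇛ sort α) k) · ss) ≠
              (nm (var (σs ⇛ sort α) k) · ts)) ∈ A
           → Step A (disagree ss ts)
    ruleFE : ∀ {σ τ} {s t : Tm (σ ⇒ τ)} k → ¬ Closed A
           → (s ≠ t) ∈ A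
           → ¬ FreeInBranch (var σ k) A
           → (∀ j → ([ app s (nm (var σ j)) ] ≠ [ app t (nm (var σ j)) ]) ∉ A)
           → Step A ((([ app s (nm (var σ k)) ] ≠ [ app t (nm (var σ k)) ]) ∷ []) ∷ [])
    ruleCon : ∀ {α} {s t u v : Tm (sort α)} → ¬ Closed A
           → (s ≐ t) ∈ A → (u ≠ v) ∈ A
           → Step A ((s ≠ u ∷ t ≠ u ∷ []) ∷
                     (s ≠ v ∷ t ≠ v ∷ []) ∷ [])
    ruleAll : ∀ {α} {s : Tm (sort α ⇒ o)} (u : Tm (sort α)) → ¬ Closed A
           → (∀'[ α ] s) ∈ A
           → Normal u → EFO u
           → AllAdmissible A α s u
           → Step A (([ app s u ] ∷ []) ∷ [])
    ruleAllN : ∀ {α} {s : Tm (sort α ⇒ o)} k → ¬ Closed A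
           → ¬' (∀'[ α ] s) ∈ A
           → ¬ FreeInBranch (var (sort α) k) A
           → (∀ j → ¬' [ app s (nm (var (sort α) j)) ] ∉ A)
           → Step A ((¬' [ app s (nm (var (sort α) k)) ] ∷ []) ∷ [])

  data Refutable : List (Tm o) → Set where
    refute : ∀ {A Cs} → EFOBranch A → Step A Cs
             → All (λ C → Refutable (C ++ A)) Cs → Refutable A

-- Soundness is proved rule by rule: in every admitted instance A / A ∪ C₁, …, A ∪ Cₙ,
-- a model of A is (or, for the fresh-variable rules FE and AllN, can be updated at the
-- fresh variable to become) a model of some A ∪ Cᵢ.  Case distinctions over values are legitimate
-- constructively because the logical identity =_σ makes equality in every D σ decidable.

module Submission where

open import Defs
open import Relation.Nullary using (¬_)
open import Data.List using (List)

open import Data.Nat using (ℕ)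
open import Data.Bool using (Bool; true; false; not; _∨_)
open import Data.Bool.Properties using (not-involutive; ¬-not)
open import Data.Product using (_×_; _,_; proj₂)
open import Data.Sum using (_⊎_; inj₁; inj₂)
open import Data.Empty using (⊥; ⊥-elim)
open import Data.List using ([]; _∷_; _++_)
open import Data.List.Relation.Unary.All as All using (All; []; _∷_)
open import Data.List.Relation.Unary.Any using (here; there)
open import Data.List.Membership.Propositional using (_∈_)
open import Data.List.Membership.Propositional.Properties using (∈-++⁻)
open import Relation.Nullary using (yes; no)
open import Relation.Nullary.Decidable using (decidable-stable)
open import Relation.Binary.Definitions using (DecidableEquality)
open import Relation.Binary.PropositionalEquality
  using (_≡_; _≢_; refl; sym; trans; cong; cong₂; subst; module ≡-Reasoning)

≡-≢-split : {X : Set} → DecidableEquality X → {a b c d : X} → a ≡ b → c ≢ d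
  → (a ≢ c × b ≢ c) ⊎ (a ≢ d × b ≢ d)
≡-≢-split _≟_ {a} {b} {c} {d} a≡b c≢d with a ≟ c
... | no a≢c = inj₁ (a≢c , λ b≡c → a≢c (trans a≡b b≡c))
... | yes a≡c = inj₂ ( (λ a≡d → c≢d (trans (sym a≡c) a≡d))
                     , (λ b≡d → c≢d (trans (sym a≡c) (trans a≡b b≡d))) )

module _ (F : Frame) where
  open Frame F
  open Interp using (asg; val)

  update-≢ : (I : Asg F) {σ : Ty} (x : Name σ) (a : D σ) {τ : Ty} (y : Name τ)
    → ¬ SameName x y → update F I x a y ≡ I y
  update-≢ I {σ} x a {τ} y x≢y with σ ≟Ty τ
  ... | no _ = refl
  ... | yes refl with x ≟Name y
  ...   | yes refl = ⊥-elim (x≢y refl)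
  ...   | no _ = refl

  update-≡ : (I : Asg F) {σ : Ty} (x : Name σ) (a : D σ) → update F I x a x ≡ a
  update-≡ I {σ} x a with σ ≟Ty σ
  ... | no σ≢σ = ⊥-elim (σ≢σ refl)
  ... | yes refl with x ≟Name x
  ...   | yes _ = refl
  ...   | no x≢x = ⊥-elim (x≢x refl)

  update-cong : (I J : Asg F) {σ : Ty} (x : Name σ) (a : D σ) {τ : Ty} (y : Name τ)
    → (¬ SameName x y → I y ≡ J y) → update F I x a y ≡ update F J x a y
  update-cong I J {σ} x a {τ} y I≡J with σ ≟Ty τ
  ... | no σ≢τ = I≡J (λ { refl → σ≢τ refl })
  ... | yes refl with x ≟Name y
  ...   | yes _ = refl
  ...   | no x≢y = I≡J (λ { refl → x≢y refl })

  Eval-functional : ∀ {I : Asg F} {σ} {s : Tm σ} {a b} → Eval F I s a → Eval F I s b → a ≡ b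
  Eval-functional (ev-nm x) (ev-nm .x) = refl
  Eval-functional (ev-app s⇓ t⇓) (ev-app s⇓′ t⇓′) =
    cong₂ ap (Eval-functional s⇓ s⇓′) (Eval-functional t⇓ t⇓′)
  Eval-functional {a = f} {b = g} (ev-lam s⇓) (ev-lam s⇓′) =
    ext f g (λ a → Eval-functional (s⇓ a) (s⇓′ a))

  Eval-free-cong : ∀ {I J : Asg F} {σ} {s : Tm σ} {v} → Eval F I s v
    → (∀ {τ} (y : Name τ) → FreeIn y s → I y ≡ J y) → Eval F J s v
  Eval-free-cong {J = J} (ev-nm y) I≡J =
    subst (Eval F J (nm y)) (sym (I≡J y (free-nm refl))) (ev-nm y)
  Eval-free-cong (ev-app s⇓ t⇓) I≡J =
    ev-app (Eval-free-cong s⇓ (λ y p → I≡J y (free-appˡ p)))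
           (Eval-free-cong t⇓ (λ y p → I≡J y (free-appʳ p)))
  Eval-free-cong {I} {J} (ev-lam {x = x} s⇓) I≡J = ev-lam λ a →
    Eval-free-cong (s⇓ a) λ y p →
      update-cong I J x a y λ x≢y → I≡J y (free-lam (λ y≡x → x≢y (sym y≡x)) p)

  Eval-lam⁻ : ∀ {I : Asg F} {σ τ} {x : Name σ} {s : Tm τ} {f} → Eval F I (lam x s) f
    → ∀ a → Eval F (update F I x a) s (ap f a)
  Eval-lam⁻ (ev-lam s⇓) = s⇓

  val-nm : (𝓘 : Interp F) {σ : Ty} (x : Name σ) → val 𝓘 (nm x) ≡ asg 𝓘 x
  val-nm 𝓘 x = Eval-functional (proj₂ (Interp.total 𝓘 (nm x))) (ev-nm x)

  val-app : (𝓘 : Interp F) {σ τ : Ty} (s : Tm (σ ⇒ τ)) (t : Tm σ)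
    → val 𝓘 (app s t) ≡ ap (val 𝓘 s) (val 𝓘 t)
  val-app 𝓘 s t =
    Eval-functional (proj₂ (Interp.total 𝓘 (app s t)))
                    (ev-app (proj₂ (Interp.total 𝓘 s)) (proj₂ (Interp.total 𝓘 t)))

  -- Totality of the updated assignment is inherited from totality at λx.s.
  _[_≔_] : Interp F → {σ : Ty} → Name σ → D σ → Interp F
  𝓘 [ x ≔ a ] = record
    { asg = update F (asg 𝓘) x a
    ; total = λ s → ap (val 𝓘 (lam x s)) a
                  , Eval-lam⁻ (proj₂ (Interp.total 𝓘 (lam x s))) a
    }

  val-≔-fresh : (𝓘 : Interp F) {σ : Ty} (x : Name σ) (a : D σ) {τ : Ty} (s : Tm τ)
    → ¬ FreeIn x s → val (𝓘 [ x ≔ a ]) s ≡ val 𝓘 s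
  val-≔-fresh 𝓘 x a s x∉s =
    Eval-functional (proj₂ (Interp.total (𝓘 [ x ≔ a ]) s))
      (Eval-free-cong (proj₂ (Interp.total 𝓘 s)) λ y y∈s →
        sym (update-≢ (asg 𝓘) x a y λ { refl → x∉s y∈s }))

  val-≔-self : (𝓘 : Interp F) {σ : Ty} (x : Name σ) (a : D σ) → val (𝓘 [ x ≔ a ]) (nm x) ≡ a
  val-≔-self 𝓘 x a = trans (val-nm (𝓘 [ x ≔ a ]) x) (update-≡ (asg 𝓘) x a)

  Logical-≔-var : (𝓘 : Interp F) → Logical F 𝓘 → {σ : Ty} (k : ℕ) (a : D σ)
    → Logical F (𝓘 [ var σ k ≔ a ])
  Logical-≔-var 𝓘 L {σ} k a = record
    { bool = bool ; bool-inj = bool-inj ; bool-sur = bool-sur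
    ; l-neg = λ b → subst (λ c → bool (ap c b) ≡ not (bool b))
                          (sym (unchanged neg (λ ()))) (l-neg b)
    ; l-imp = λ b c → subst (λ i → bool (ap (ap i b) c) ≡ (not (bool b) ∨ bool c))
                            (sym (unchanged imp (λ ()))) (l-imp b c)
    ; l-eq₁ = λ τ b c e → l-eq₁ τ b c (subst (λ q → bool (ap (ap q b) c) ≡ true)
                                             (unchanged (eq τ) (λ ())) e)
    ; l-eq₂ = λ τ b c e → subst (λ q → bool (ap (ap q b) c) ≡ true)
                                (sym (unchanged (eq τ) (λ ()))) (l-eq₂ τ b c e)
    ; l-all₁ = λ α f e → l-all₁ α f (subst (λ q → bool (ap q f) ≡ true)
                                           (unchanged (all α) (λ ())) e)
    ; l-all₂ = λ α f h → subst (λ q → bool (ap q f) ≡ true)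
                               (sym (unchanged (all α) (λ ()))) (l-all₂ α f h)
    }
    where
      open Logical L
      unchanged : ∀ {τ} (c : Name τ) → ¬ SameName (var σ k) c
        → update F (asg 𝓘) (var σ k) a c ≡ asg 𝓘 c
      unchanged = update-≢ (asg 𝓘) (var σ k) a

  module Truth {𝓘 : Interp F} (L : Logical F 𝓘) where
    open Logical L

    ⟦_⟧ : Tm o → Bool
    ⟦ s ⟧ = bool (val 𝓘 s)

    ⊨_ : Tm o → Set
    ⊨ s = ⟦ s ⟧ ≡ true

    ⟦¬⟧ : ∀ s → ⟦ ¬' s ⟧ ≡ not ⟦ s ⟧
    ⟦¬⟧ s rewrite val-app 𝓘 (nm neg) s | val-nm 𝓘 neg = l-neg (val 𝓘 s)

    ⟦⟶⟧ : ∀ s t → ⟦ s ⟶ t ⟧ ≡ (not ⟦ s ⟧ ∨ ⟦ t ⟧)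
    ⟦⟶⟧ s t rewrite val-app 𝓘 (app (nm imp) s) t | val-app 𝓘 (nm imp) s | val-nm 𝓘 imp =
      l-imp (val 𝓘 s) (val 𝓘 t)

    ⟦≐⟧ : ∀ {σ} (s t : Tm σ) → ⟦ s ≐ t ⟧ ≡ bool (ap (ap (asg 𝓘 (eq σ)) (val 𝓘 s)) (val 𝓘 t))
    ⟦≐⟧ {σ} s t rewrite val-app 𝓘 (app (nm (eq σ)) s) t | val-app 𝓘 (nm (eq σ)) s | val-nm 𝓘 (eq σ) = refl

    ⟦∀⟧ : ∀ α (s : Tm (sort α ⇒ o)) → ⟦ ∀'[ α ] s ⟧ ≡ bool (ap (asg 𝓘 (all α)) (val 𝓘 s))
    ⟦∀⟧ α s rewrite val-app 𝓘 (nm (all α)) s | val-nm 𝓘 (all α) = refl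

    _≟D_ : ∀ {σ} → DecidableEquality (D σ)
    _≟D_ {σ} a b with bool (ap (ap (asg 𝓘 (eq σ)) a) b) in a=b
    ... | true = yes (l-eq₁ σ a b a=b)
    ... | false = no λ a≡b → case (trans (sym (l-eq₂ σ a b a≡b)) a=b)
      where case : true ≢ false
            case ()

    ⊨¬-intro : ∀ {s} → ⟦ s ⟧ ≡ false → ⊨ ¬' s
    ⊨¬-intro {s} s=false rewrite ⟦¬⟧ s | s=false = refl

    ⊨¬⇒⊭ : ∀ {s} → ⊨ ¬' s → ¬ ⊨ s
    ⊨¬⇒⊭ {s} ⊨¬s ⊨s with trans (sym ⊨¬s) (trans (⟦¬⟧ s) (cong not ⊨s))
    ... | ()

    ⊨≐⇒≡ : ∀ {σ} {s t : Tm σ} → ⊨ (s ≐ t) → val 𝓘 s ≡ val 𝓘 t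
    ⊨≐⇒≡ {σ} {s} {t} ⊨s=t = l-eq₁ σ _ _ (trans (sym (⟦≐⟧ s t)) ⊨s=t)

    ⊨≠⇒≢ : ∀ {σ} {s t : Tm σ} → ⊨ (s ≠ t) → val 𝓘 s ≢ val 𝓘 t
    ⊨≠⇒≢ {σ} {s} {t} ⊨s≠t s≡t = ⊨¬⇒⊭ ⊨s≠t (trans (⟦≐⟧ s t) (l-eq₂ σ _ _ s≡t))

    ≢⇒⊨≠ : ∀ {σ} {s t : Tm σ} → val 𝓘 s ≢ val 𝓘 t → ⊨ (s ≠ t)
    ≢⇒⊨≠ {s = s} {t} s≢t with ⟦ s ≐ t ⟧ in s=t
    ... | true = ⊥-elim (s≢t (⊨≐⇒≡ s=t))
    ... | false = ⊨¬-intro s=t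

    ⊨∀⇒ : ∀ {α} {s : Tm (sort α ⇒ o)} → ⊨ ∀'[ α ] s → ∀ a → bool (ap (val 𝓘 s) a) ≡ true
    ⊨∀⇒ {α} {s} ⊨∀s = l-all₁ α (val 𝓘 s) (trans (sym (⟦∀⟧ α s)) ⊨∀s)

    ⇒⊨∀ : ∀ {α} {s : Tm (sort α ⇒ o)} → (∀ a → bool (ap (val 𝓘 s) a) ≡ true) → ⊨ ∀'[ α ] s
    ⇒⊨∀ {α} {s} h = trans (⟦∀⟧ α s) (l-all₂ α (val 𝓘 s) h)

    ⊨¬¬⇒ : ∀ {s} → ⊨ ¬' (¬' s) → ⊨ s
    ⊨¬¬⇒ {s} ⊨¬¬s = trans (sym (not-involutive ⟦ s ⟧))
                          (trans (cong not (sym (⟦¬⟧ s))) (trans (sym (⟦¬⟧ (¬' s))) ⊨¬¬s))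

    ⊨≠ₒ⇒ : ∀ {s t : Tm o} → ⊨ (s ≠ t) → (⊨ s × ⊨ ¬' t) ⊎ (⊨ ¬' s × ⊨ t)
    ⊨≠ₒ⇒ {s} {t} ⊨s≠t with ⟦ s ⟧ in s=b | ⟦ t ⟧ in t=b
    ... | true  | false = inj₁ (refl , ⊨¬-intro t=b)
    ... | false | true  = inj₂ (⊨¬-intro s=b , refl)
    ... | true  | true  = ⊥-elim (⊨≠⇒≢ ⊨s≠t (bool-inj _ _ (trans s=b (sym t=b))))
    ... | false | false = ⊥-elim (⊨≠⇒≢ ⊨s≠t (bool-inj _ _ (trans s=b (sym t=b))))

    ⊨⟶⇒ : ∀ {s t} → ⊨ (s ⟶ t) → ⊨ ¬' s ⊎ ⊨ t
    ⊨⟶⇒ {s} {t} ⊨s⟶t with ⟦ s ⟧ in s=b | ⟦ t ⟧ in t=b | trans (sym (⟦⟶⟧ s t)) ⊨s⟶t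
    ... | false | _     | _ = inj₁ (⊨¬-intro s=b)
    ... | true  | true  | _ = inj₂ refl

    ⊨¬⟶⇒ : ∀ {s t} → ⊨ ¬' (s ⟶ t) → ⊨ s × ⊨ ¬' t
    ⊨¬⟶⇒ {s} {t} ⊨¬s⟶t with ⟦ s ⟧ in s=b | ⟦ t ⟧ in t=b | ⟦⟶⟧ s t
    ... | true  | false | _ = refl , ⊨¬-intro t=b
    ... | false | _     | s⟶t=true = ⊥-elim (⊨¬⇒⊭ ⊨¬s⟶t s⟶t=true)
    ... | true  | true  | s⟶t=true = ⊥-elim (⊨¬⇒⊭ ⊨¬s⟶t s⟶t=true)

  module Soundness (𝒩 : Normalizer) where
    open Normalizer 𝒩
    open Calculus 𝒩

    val-≔-instance : (𝓘 : Interp F) {σ τ : Ty} (x : Name σ) (a : D σ) (s : Tm (σ ⇒ τ))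
      → ¬ FreeIn x s → val (𝓘 [ x ≔ a ]) [ app s (nm x) ] ≡ ap (val 𝓘 s) a
    val-≔-instance 𝓘 x a s x∉s = begin
      val 𝓘′ [ app s (nm x) ]        ≡⟨ N4 F 𝓘′ (app s (nm x)) ⟩
      val 𝓘′ (app s (nm x))          ≡⟨ val-app 𝓘′ s (nm x) ⟩
      ap (val 𝓘′ s) (val 𝓘′ (nm x))  ≡⟨ cong₂ ap (val-≔-fresh 𝓘 x a s x∉s) (val-≔-self 𝓘 x a) ⟩
      ap (val 𝓘 s) a                 ∎
      where
        open ≡-Reasoning
        𝓘′ = 𝓘 [ x ≔ a ]

    module _ {A : List (Tm o)} (M : Model F A) where
      open Model M using (interp; logical; sat)
      open Logical logical using (bool)
      open Truth logical

      Unsat : List (Tm o) → Set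
      Unsat C = ¬ Model F (C ++ A)

      extend : ∀ {C} → All ⊨_ C → Model F (C ++ A)
      extend {C} ⊨C = record { interp = interp ; logical = logical ; sat = λ m → ⊨-∈ (∈-++⁻ C m) }
        where
          ⊨-∈ : ∀ {s} → s ∈ C ⊎ s ∈ A → ⊨ s
          ⊨-∈ (inj₁ m) = All.lookup ⊨C m
          ⊨-∈ (inj₂ m) = sat m

      extend-fresh : ∀ {σ} (k : ℕ) (a : D σ) → ¬ FreeInBranch (var σ k) A → ∀ {v}
        → Truth.⊨_ (Logical-≔-var interp logical k a) v → Model F (v ∷ A)
      extend-fresh {σ} k a k∉A {v} ⊨v = record
        { interp = interp [ var σ k ≔ a ] ; logical = Logical-≔-var interp logical k a ; sat = ⊨-∈ }
        where
          ⊨-∈ : ∀ {s} → s ∈ v ∷ A → bool (val (interp [ var σ k ≔ a ]) s) ≡ true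
          ⊨-∈ (here refl) = ⊨v
          ⊨-∈ (there m) = trans (cong bool (val-≔-fresh interp _ a _ λ k∈s → k∉A (_ , m , k∈s))) (sat m)

      val-·-≡ : ∀ {σs ρ} (h h′ : Tm (σs ⇛ ρ)) (ss ts : Args σs) → val interp h ≡ val interp h′
        → All Unsat (disagree ss ts) → val interp (h · ss) ≡ val interp (h′ · ts)
      val-·-≡ h h′ [] [] h≡h′ [] = h≡h′
      val-·-≡ h h′ (s ∷ ss) (t ∷ ts) h≡h′ (s≠t-unsat ∷ rest) = val-·-≡ (app h s) (app h′ t) ss ts hs≡h′t rest
        where
          s≡t : val interp s ≡ val interp t
          s≡t = decidable-stable (_ ≟D _) λ s≢t → s≠t-unsat (extend (≢⇒⊨≠ s≢t ∷ []))
          hs≡h′t : val interp (app h s) ≡ val interp (app h′ t)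
          hs≡h′t = trans (val-app interp h s) (trans (cong₂ ap h≡h′ s≡t) (sym (val-app interp h′ t)))

      step-sound : ∀ {Cs} → Step A Cs → All Unsat Cs → ⊥
      step-sound (ruleDN _ p) (¬M ∷ []) = ¬M (extend (⊨¬¬⇒ (sat p) ∷ []))
      step-sound (ruleBE _ p) (¬M₁ ∷ ¬M₂ ∷ []) with ⊨≠ₒ⇒ (sat p)
      ... | inj₁ (⊨s , ⊨¬t) = ¬M₁ (extend (⊨s ∷ ⊨¬t ∷ []))
      ... | inj₂ (⊨¬s , ⊨t) = ¬M₂ (extend (⊨¬s ∷ ⊨t ∷ []))
      step-sound (ruleImp _ p) (¬M₁ ∷ ¬M₂ ∷ []) with ⊨⟶⇒ (sat p)
      ... | inj₁ ⊨¬s = ¬M₁ (extend (⊨¬s ∷ []))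
      ... | inj₂ ⊨t = ¬M₂ (extend (⊨t ∷ []))
      step-sound (ruleImpN _ p) (¬M ∷ []) with ⊨¬⟶⇒ (sat p)
      ... | ⊨s , ⊨¬t = ¬M (extend (⊨s ∷ ⊨¬t ∷ []))
      step-sound (ruleMat _ ss ts _ p q) ¬Ms =
        ⊨¬⇒⊭ (sat q) (subst (λ b → bool b ≡ true) (val-·-≡ _ _ ss ts refl ¬Ms) (sat p))
      step-sound (ruleDec _ _ ss ts _ p) ¬Ms = ⊨≠⇒≢ (sat p) (val-·-≡ _ _ ss ts refl ¬Ms)
      step-sound (ruleFE {σ} {s = s} {t} k _ p k∉A _) (¬M ∷ []) =
        ⊨≠⇒≢ (sat p) (ext (val interp s) (val interp t) pointwise)
        where
          k∉s : ¬ FreeIn (var σ k) s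
          k∉s k∈s = k∉A (_ , p , free-appʳ (free-appˡ (free-appʳ k∈s)))
          k∉t : ¬ FreeIn (var σ k) t
          k∉t k∈t = k∉A (_ , p , free-appʳ (free-appʳ k∈t))
          pointwise : ∀ a → ap (val interp s) a ≡ ap (val interp t) a
          pointwise a = decidable-stable (_ ≟D _) λ sa≢ta →
            ¬M (extend-fresh k a k∉A (Truth.≢⇒⊨≠ (Logical-≔-var interp logical k a) λ e →
              sa≢ta (trans (sym (val-≔-instance interp _ a s k∉s))
                           (trans e (val-≔-instance interp _ a t k∉t)))))
      step-sound (ruleCon _ p q) (¬M₁ ∷ ¬M₂ ∷ []) with ≡-≢-split _≟D_ (⊨≐⇒≡ (sat p)) (⊨≠⇒≢ (sat q))
      ... | inj₁ (s≢u , t≢u) = ¬M₁ (extend (≢⇒⊨≠ s≢u ∷ ≢⇒⊨≠ t≢u ∷ []))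
      ... | inj₂ (s≢v , t≢v) = ¬M₂ (extend (≢⇒⊨≠ s≢v ∷ ≢⇒⊨≠ t≢v ∷ []))
      step-sound (ruleAll {s = s} u _ p _ _ _) (¬M ∷ []) =
        ¬M (extend (trans (cong bool (trans (N4 F interp (app s u)) (val-app interp s u)))
                          (⊨∀⇒ (sat p) (val interp u)) ∷ []))
      step-sound (ruleAllN {α} {s} k _ p k∉A _) (¬M ∷ []) = ⊨¬⇒⊭ (sat p) (⇒⊨∀ pointwise)
        where
          k∉s : ¬ FreeIn (var (sort α) k) s
          k∉s k∈s = k∉A (_ , p , free-appʳ (free-appʳ k∈s))
          pointwise : ∀ a → bool (ap (val interp s) a) ≡ true
          pointwise a = ¬-not λ sa=false →
            ¬M (extend-fresh k a k∉A (Truth.⊨¬-intro (Logical-≔-var interp logical k a)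
              (trans (cong bool (val-≔-instance interp _ a s k∉s)) sa=false)))

    Refutable⇒Unsat : ∀ {A} → Refutable A → ¬ Model F A
    All-Refutable⇒Unsat : ∀ {A Cs} → All (λ C → Refutable (C ++ A)) Cs → All (λ C → ¬ Model F (C ++ A)) Cs
    Refutable⇒Unsat (refute _ step refutations) M = step-sound M step (All-Refutable⇒Unsat refutations)
    All-Refutable⇒Unsat [] = []
    All-Refutable⇒Unsat (r ∷ rs) = Refutable⇒Unsat r ∷ All-Refutable⇒Unsat rs

proposition14p1 : (𝒩 : Normalizer) (A : List (Tm o))
    → Calculus.Refutable 𝒩 A → ¬ Satisfiable A
proposition14p1 𝒩 A refutable (F , M) = Soundness.Refutable⇒Unsat F 𝒩 refutable M
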